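{- Let $H$ be a hypergraph of fractional hypertree width $\omega$ and let $S\subseteq V(H)$. Then $\rho^*_H(S)\le \mathrm{mis}(S)\cdot\omega$, where $\mathrm{mis}(S)$ is the maximum size of an independent set of $H$ contained in $S$.
   Context: A hypergraph $H$ has a finite vertex set $V(H)$ and a set $E(H)$ of nonempty subsets (hyperedges); every vertex lies in some hyperedge. A set $I\subseteq V(H)$ is independent if no hyperedge contains two vertices of $I$. $\rho^*_H(S)$ is the minimum of $\sum_{e\in E(H)}\gamma(e)$ over $\gamma:E(H)\to[0,1]$ with $\sum_{e\ni v}\gamma(e)\ge1$ for all $v\in S$. A tree decomposition $(T,\beta)$ of $H$: $T$ a tree, bags $\beta(u)\subseteq V(H)$, for each vertex the nodes whose bags contain it form a nonempty connected subtree, each hyperedge lies in some bag; its fractional hypertree width is $\max_u\rho^*_H(\beta(u))$, and the fractional hypertree width of $H$ is the minimum over all tree decompositions.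
   Formalization: The fractional cover weights γ take values in the rationals between 0 and 1 instead of the real interval [0,1], so the values of $\rho^*_H$ and the fractional hypertree width ω are rational. -}

module Defs where

open import Data.Nat as ℕ using (ℕ; zero; suc)
open import Data.Fin using (Fin; zero; suc; inject₁)
open import Data.Fin.Subset using (Subset; _∈_; _⊆_; ∣_∣)
open import Data.Vec using (lookup)
open import Data.Bool using (if_then_else_)
open import Data.Integer using (+_)
open import Data.Rational using (ℚ; 0ℚ; 1ℚ; _+_; _*_; _≤_; _/_)
open import Data.Product using (Σ; ∃; ∃-syntax; _×_; _,_)
open import Relation.Binary.PropositionalEquality using (_≡_)
open import Function.Definitions using (Injective)

Σℚ : (m : ℕ) → (Fin m → ℚ) → ℚ
Σℚ zero    f = 0ℚ
Σℚ (suc m) f = f zero + Σℚ m (λ i → f (suc i))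

ℕ→ℚ : ℕ → ℚ
ℕ→ℚ k = (+ k) / 1

-- A hypergraph on vertex set Fin n with m hyperedges E : Fin m → Subset n.
-- Hyperedges are pairwise distinct (E(H) is a set), nonempty, and every
-- vertex lies in some hyperedge.
record Hypergraph : Set where
  field
    n  : ℕ
    m  : ℕ
    E  : Fin m → Subset n
    E-injective : Injective _≡_ _≡_ E
    E-nonempty  : (e : Fin m) → ∃[ v ] (v ∈ E e)
    covered     : (v : Fin n) → ∃[ e ] (v ∈ E e)

module _ (H : Hypergraph) where
  open Hypergraph H

  IsFracCover : Subset n → (Fin m → ℚ) → Set
  IsFracCover S γ =
    ((e : Fin m) → (0ℚ ≤ γ e) × (γ e ≤ 1ℚ)) ×
    ((v : Fin n) → v ∈ S →
       1ℚ ≤ Σℚ m (λ e → if lookup (E e) v then γ e else 0ℚ))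

  weight : (Fin m → ℚ) → ℚ
  weight γ = Σℚ m γ

  IsRhoStar : Subset n → ℚ → Set
  IsRhoStar S r =
    (∃[ γ ] (IsFracCover S γ × weight γ ≡ r)) ×
    ((γ : Fin m → ℚ) → IsFracCover S γ → r ≤ weight γ)

  Independent : Subset n → Set
  Independent I = (e : Fin m) (u v : Fin n) →
    u ∈ I → v ∈ I → u ∈ E e → v ∈ E e → u ≡ v

  IsMis : Subset n → ℕ → Set
  IsMis S k =
    (∃[ I ] (I ⊆ S × Independent I × ∣ I ∣ ≡ k)) ×
    ((I : Subset n) → I ⊆ S → Independent I → ∣ I ∣ ℕ.≤ k)

-- A (nonempty, finite) tree with nodes Fin (suc k), rooted at node zero,
-- where node (suc i) has a parent among the nodes 0..i.  Every finite tree
-- is isomorphic to one of this form (label nodes in BFS order).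
record Tree : Set where
  field
    k      : ℕ
    parent : Fin k → Fin (suc k)
    parent-earlier : (i : Fin k) → Data.Fin.toℕ (parent i) ℕ.≤ Data.Fin.toℕ i

  Node : Set
  Node = Fin (suc k)

  data Adj : Node → Node → Set where
    up   : (i : Fin k) → Adj (suc i) (parent i)
    down : (i : Fin k) → Adj (parent i) (suc i)

  data WalkIn (X : Node → Set) : Node → Node → Set where
    here : ∀ {a} → X a → WalkIn X a a
    step : ∀ {a b c} → X a → Adj a b → WalkIn X b c → WalkIn X a c

  Connected : (Node → Set) → Set
  Connected X = ∀ a b → X a → X b → WalkIn X a b

module _ (H : Hypergraph) where
  open Hypergraph H

  record TreeDecomposition : Set where
    field
      T    : Tree
    open Tree T public
    field
      bag  : Node → Subset n
      vertex-nonempty  : (v : Fin n) → ∃[ u ] (v ∈ bag u)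
      vertex-connected : (v : Fin n) → Connected (λ u → v ∈ bag u)
      edge-covered     : (e : Fin m) → ∃[ u ] (E e ⊆ bag u)

  HasWidth : TreeDecomposition → ℚ → Set
  HasWidth D w =
    (∃[ u ] IsRhoStar H (bag u) w) ×
    ((u : Node) (r : ℚ) → IsRhoStar H (bag u) r → r ≤ w)
    where open TreeDecomposition D

  IsFHW : ℚ → Set
  IsFHW ω =
    (∃[ D ] HasWidth D ω) ×
    ((D : TreeDecomposition) (w : ℚ) → HasWidth D w → ω ≤ w)

{-# OPTIONS --safe #-}

-- Number the nodes of the tree decomposition so that parents precede children, and let top v
-- be the first node whose bag contains v; the nodes whose bags contain v form the subtree below
-- top v.  Choose v ∈ S with top v as late as possible and let B be its bag.  Every w ∈ S sharing
-- a hyperedge with v lies in B: the bag of that hyperedge is below top v, and a walk from it to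
-- top w through bags containing w either stays below top v, forcing top w = top v, or passes
-- through top v.  Hence v extends every independent subset of S ∖ B, so mis(S ∖ B) < mis(S),
-- and by induction the pointwise maximum of a cover of B of weight ω and a cover of S ∖ B of
-- weight (mis(S) − 1)·ω covers S.
--
-- Covers of the bags of weight ω exist because the fractional cover LP attains its minimum:
-- Fourier–Motzkin elimination projects {(γ , t) | γ covers, weight γ ≤ t} onto the t-axis as a
-- finite system of inequalities in t, whose least solution lifts back to an optimal γ.

module Submission where

open import Defs
open import Data.Nat using (ℕ; zero; suc)
open import Data.Fin.Subset using (Subset)
open import Data.Rational using (ℚ; _≤_; _*_)

import Data.Nat as ℕ
import Data.Nat.Properties as ℕP
import Data.Nat.Coprimality as Coprimality
import Data.Integer as ℤ
import Data.Integer.Properties as ℤP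
open import Data.Fin using (Fin; zero; suc; toℕ; _↑ˡ_; _↑ʳ_)
import Data.Fin.Properties as FinP
open import Data.Fin.Subset using (_∈_; _∉_; _⊆_; _∪_; _∩_; ∁; ⁅_⁆; ∣_∣; Empty)
import Data.Fin.Subset.Properties as SubsetP
open import Data.Rational
  using (mkℚ; 0ℚ; 1ℚ; _+_; -_; _-_; 1/_; _÷_; _<_; _⊔_; _≟_; NonZero; >-nonZero; <-nonZero;
         positive; negative; nonNegative; nonPositive)
import Data.Rational.Properties as ℚP
open import Data.Rational.Solver using (module +-*-Solver)
open +-*-Solver using (solve; _:+_; _:*_; :-_; _:-_; _:=_; con)
open import Data.Bool using (Bool; true; false; if_then_else_)
open import Data.Vec using (lookup)
import Data.Vec.Properties as VecP
open import Data.Vec.Functional as Vector using (Vector; []; _∷_; head; tail)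
import Data.Vec.Functional.Properties as VectorP
open import Data.List using (List; map; filter; tabulate; _++_; _∷ʳ_; cartesianProductWith; allFin)
open import Data.List.Relation.Unary.All as All using (All)
import Data.List.Relation.Unary.All.Properties as AllP
open import Data.List.Membership.Propositional using () renaming (_∈_ to _∈ₗ_)
open import Data.List.Membership.Propositional.Properties
  using (∈-filter⁺; ∈-++⁺ˡ; ∈-++⁺ʳ; ∈-cartesianProductWith⁺; ∈-allFin)
open import Relation.Binary.Bundles using (DecTotalOrder)
import Data.List.Extrema (DecTotalOrder.totalOrder ℚP.≤-decTotalOrder) as ℚExtrema
import Data.List.Extrema ℕP.≤-totalOrder as ℕExtrema
open import Data.Product using (∃; ∃-syntax; _×_; _,_; proj₁; proj₂)
open import Data.Sum using (_⊎_; inj₁; inj₂)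
open import Data.Empty using (⊥; ⊥-elim)
open import Function using (_∘_; _⇔_; mk⇔; Equivalence)
open import Relation.Binary.Definitions using (tri<; tri≈; tri>)
open import Relation.Binary.PropositionalEquality
open import Relation.Nullary using (Dec; yes; no)
open import Relation.Unary using (Decidable)

0≤1 : 0ℚ ≤ 1ℚ
0≤1 = ℚP.nonNegative⁻¹ 1ℚ

p-q+q≡p : ∀ p q → p - q + q ≡ p
p-q+q≡p = solve 2 (λ p q → p :- q :+ q := p) refl

p≤q+r⇔p-r≤q : ∀ p q r → p ≤ q + r ⇔ p - r ≤ q
p≤q+r⇔p-r≤q p q r = mk⇔
  (λ p≤q+r → subst (p - r ≤_) (p+q-q≡p q r) (ℚP.+-monoˡ-≤ (- r) p≤q+r))
  (λ p-r≤q → subst (_≤ q + r) (p-q+q≡p p r) (ℚP.+-monoˡ-≤ r p-r≤q))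
  where
  p+q-q≡p : ∀ p q → p + q - q ≡ p
  p+q-q≡p = solve 2 (λ p q → p :+ q :- q := p) refl

p≤q⇔0≤q-p : ∀ p q → p ≤ q ⇔ 0ℚ ≤ q - p
p≤q⇔0≤q-p p q = mk⇔
  (λ p≤q → subst (_≤ q - p) (ℚP.+-inverseʳ p) (ℚP.+-monoˡ-≤ (- p) p≤q))
  (λ 0≤q-p → subst₂ _≤_ (ℚP.+-identityˡ p) (p-q+q≡p q p) (ℚP.+-monoˡ-≤ p 0≤q-p))

p⊔q≤p+q : ∀ {p q} → 0ℚ ≤ p → 0ℚ ≤ q → p ⊔ q ≤ p + q
p⊔q≤p+q {p} {q} 0≤p 0≤q = ℚP.⊔-lub
  (subst (_≤ p + q) (ℚP.+-identityʳ p) (ℚP.+-monoʳ-≤ p 0≤q))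
  (subst (_≤ p + q) (ℚP.+-identityˡ q) (ℚP.+-monoˡ-≤ q 0≤p))

+-cancelˡ-≤ : ∀ r {p q} → r + p ≤ r + q → p ≤ q
+-cancelˡ-≤ r {p} {q} r+p≤r+q = subst₂ _≤_ (cancel r p) (cancel r q) (ℚP.+-monoʳ-≤ (- r) r+p≤r+q)
  where
  cancel : ∀ r p → - r + (r + p) ≡ p
  cancel = solve 2 (λ r p → :- r :+ (r :+ p) := p) refl

*-÷-inverse : ∀ a b .{{_ : NonZero a}} → a * (b ÷ a) ≡ b
*-÷-inverse a b = begin
  a * (b * 1/ a)   ≡⟨ swap a b _ ⟩
  b * (a * 1/ a)   ≡⟨ cong (b *_) (ℚP.*-inverseʳ a) ⟩
  b * 1ℚ           ≡⟨ ℚP.*-identityʳ b ⟩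
  b                ∎
  where
  open ≡-Reasoning
  swap : ∀ a b c → a * (b * c) ≡ b * (a * c)
  swap = solve 3 (λ a b c → a :* (b :* c) := b :* (a :* c)) refl

≤-affine⇔ : ∀ a b s t .{{_ : NonZero a}} → b ≤ a * t + s ⇔ a * ((b - s) ÷ a) ≤ a * t
≤-affine⇔ a b s t = mk⇔
  (λ h → subst (_≤ a * t) (sym (*-÷-inverse a (b - s))) (Equivalence.to (p≤q+r⇔p-r≤q b (a * t) s) h))
  (λ h → Equivalence.from (p≤q+r⇔p-r≤q b (a * t) s) (subst (_≤ a * t) (*-÷-inverse a (b - s)) h))

neg-involutive : ∀ p → - (- p) ≡ p
neg-involutive = solve 1 (λ p → :- (:- p) := p) refl

ℕ→ℚ≡mkℚ : ∀ k → ℕ→ℚ k ≡ mkℚ (ℤ.+ k) 0 (Coprimality.sym (Coprimality.1-coprimeTo k))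
ℕ→ℚ≡mkℚ k = ℚP.normalize-coprime (Coprimality.sym (Coprimality.1-coprimeTo k))

ℕ→ℚ-suc : ∀ k → ℕ→ℚ (suc k) ≡ 1ℚ + ℕ→ℚ k
ℕ→ℚ-suc k rewrite ℕ→ℚ≡mkℚ k =
  ℚP./-cong (cong (ℤ._+_ (ℤ.+ 1)) (sym (ℤP.*-identityʳ (ℤ.+ k)))) refl

ℕ→ℚ-suc-* : ∀ k p → ℕ→ℚ (suc k) * p ≡ p + ℕ→ℚ k * p
ℕ→ℚ-suc-* k p = begin
  ℕ→ℚ (suc k) * p      ≡⟨ cong (_* p) (ℕ→ℚ-suc k) ⟩
  (1ℚ + ℕ→ℚ k) * p     ≡⟨ ℚP.*-distribʳ-+ p 1ℚ (ℕ→ℚ k) ⟩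
  1ℚ * p + ℕ→ℚ k * p   ≡⟨ cong (_+ ℕ→ℚ k * p) (ℚP.*-identityˡ p) ⟩
  p + ℕ→ℚ k * p        ∎
  where open ≡-Reasoning

ℕ→ℚ-nonNeg : ∀ k → 0ℚ ≤ ℕ→ℚ k
ℕ→ℚ-nonNeg k = ℚP.nonNegative⁻¹ (ℕ→ℚ k) {{ℚP.normalize-nonNeg k 1}}

Σℚ-cong : ∀ m {f g : Fin m → ℚ} → (∀ i → f i ≡ g i) → Σℚ m f ≡ Σℚ m g
Σℚ-cong zero    f≗g = refl
Σℚ-cong (suc m) f≗g = cong₂ _+_ (f≗g zero) (Σℚ-cong m (f≗g ∘ suc))

Σℚ-mono-≤ : ∀ m {f g : Fin m → ℚ} → (∀ i → f i ≤ g i) → Σℚ m f ≤ Σℚ m g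
Σℚ-mono-≤ zero    f≤g = ℚP.≤-refl
Σℚ-mono-≤ (suc m) f≤g = ℚP.+-mono-≤ (f≤g zero) (Σℚ-mono-≤ m (f≤g ∘ suc))

Σℚ-zero : ∀ m → Σℚ m (λ _ → 0ℚ) ≡ 0ℚ
Σℚ-zero zero    = refl
Σℚ-zero (suc m) = trans (cong (0ℚ +_) (Σℚ-zero m)) (ℚP.+-identityˡ 0ℚ)

Σℚ-nonNeg : ∀ m {f : Fin m → ℚ} → (∀ i → 0ℚ ≤ f i) → 0ℚ ≤ Σℚ m f
Σℚ-nonNeg m {f} 0≤f = subst (_≤ Σℚ m f) (Σℚ-zero m) (Σℚ-mono-≤ m 0≤f)

Σℚ-distrib-+ : ∀ m (f g : Fin m → ℚ) → Σℚ m (λ i → f i + g i) ≡ Σℚ m f + Σℚ m g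
Σℚ-distrib-+ zero    f g = sym (ℚP.+-identityˡ 0ℚ)
Σℚ-distrib-+ (suc m) f g =
  trans (cong (f zero + g zero +_) (Σℚ-distrib-+ m (f ∘ suc) (g ∘ suc)))
        (interchange (f zero) (g zero) _ _)
  where
  interchange : ∀ a b c d → (a + b) + (c + d) ≡ (a + c) + (b + d)
  interchange = solve 4 (λ a b c d → (a :+ b) :+ (c :+ d) := (a :+ c) :+ (b :+ d)) refl

*-distribˡ-Σℚ : ∀ m u (f : Fin m → ℚ) → u * Σℚ m f ≡ Σℚ m (λ i → u * f i)
*-distribˡ-Σℚ zero    u f = ℚP.*-zeroʳ u
*-distribˡ-Σℚ (suc m) u f = trans (ℚP.*-distribˡ-+ u (f zero) _)
                                  (cong (u * f zero +_) (*-distribˡ-Σℚ m u (f ∘ suc)))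

neg-distrib-Σℚ : ∀ m (f : Fin m → ℚ) → - Σℚ m f ≡ Σℚ m (λ i → - f i)
neg-distrib-Σℚ zero    f = refl
neg-distrib-Σℚ (suc m) f = trans (ℚP.neg-distrib-+ (f zero) _)
                                 (cong (- f zero +_) (neg-distrib-Σℚ m (f ∘ suc)))

Σℚ-≥-term : ∀ m {f : Fin m → ℚ} → (∀ i → 0ℚ ≤ f i) → ∀ i → f i ≤ Σℚ m f
Σℚ-≥-term (suc m) {f} 0≤f zero    =
  subst (_≤ Σℚ (suc m) f) (ℚP.+-identityʳ (f zero)) (ℚP.+-monoʳ-≤ (f zero) (Σℚ-nonNeg m (0≤f ∘ suc)))
Σℚ-≥-term (suc m) {f} 0≤f (suc i) =
  subst (_≤ Σℚ (suc m) f) (ℚP.+-identityˡ (f (suc i))) (ℚP.+-mono-≤ (0≤f zero) (Σℚ-≥-term m (0≤f ∘ suc) i))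

Σℚ-++ : ∀ m {n} (f : Fin (m ℕ.+ n) → ℚ) → Σℚ (m ℕ.+ n) f ≡ Σℚ m (f ∘ (_↑ˡ n)) + Σℚ n (f ∘ (m ↑ʳ_))
Σℚ-++ zero    f = sym (ℚP.+-identityˡ _)
Σℚ-++ (suc m) f = trans (cong (f zero +_) (Σℚ-++ m (f ∘ suc))) (sym (ℚP.+-assoc (f zero) _ _))

infix 7 _·_
_·_ : ∀ {d} → Vector ℚ d → Vector ℚ d → ℚ
_·_ {d} a x = Σℚ d (λ i → a i * x i)

·-cong : ∀ {d} {a b x y : Vector ℚ d} → (∀ i → a i ≡ b i) → (∀ i → x i ≡ y i) → a · x ≡ b · y
·-cong {d} a≗b x≗y = Σℚ-cong d (λ i → cong₂ _*_ (a≗b i) (x≗y i))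

·-linearˡ : ∀ {d} u w (a b x : Vector ℚ d) →
  (λ i → u * a i + w * b i) · x ≡ u * (a · x) + w * (b · x)
·-linearˡ {d} u w a b x = begin
  Σℚ d (λ i → (u * a i + w * b i) * x i)              ≡⟨ Σℚ-cong d (λ i → distrib u w (a i) (b i) (x i)) ⟩
  Σℚ d (λ i → u * (a i * x i) + w * (b i * x i))      ≡⟨ Σℚ-distrib-+ d _ _ ⟩
  Σℚ d (λ i → u * (a i * x i)) + Σℚ d (λ i → w * (b i * x i))
    ≡⟨ cong₂ _+_ (sym (*-distribˡ-Σℚ d u _)) (sym (*-distribˡ-Σℚ d w _)) ⟩
  u * (a · x) + w * (b · x)                           ∎
  where
  open ≡-Reasoning
  distrib : ∀ u w a b x → (u * a + w * b) * x ≡ u * (a * x) + w * (b * x)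
  distrib = solve 5 (λ u w a b x → (u :* a :+ w :* b) :* x := u :* (a :* x) :+ w :* (b :* x)) refl

unit : ∀ {m} → Fin m → Vector ℚ m
unit zero    zero    = 1ℚ
unit zero    (suc _) = 0ℚ
unit (suc _) zero    = 0ℚ
unit (suc e) (suc i) = unit e i

unit-· : ∀ {m} (e : Fin m) (x : Vector ℚ m) → unit e · x ≡ x e
unit-· {suc m} zero x = begin
  1ℚ * x zero + Σℚ m (λ i → 0ℚ * x (suc i))
    ≡⟨ cong₂ _+_ (ℚP.*-identityˡ (x zero)) (Σℚ-cong m (λ i → ℚP.*-zeroˡ (x (suc i)))) ⟩
  x zero + Σℚ m (λ _ → 0ℚ)                     ≡⟨ cong (x zero +_) (Σℚ-zero m) ⟩
  x zero + 0ℚ                                  ≡⟨ ℚP.+-identityʳ (x zero) ⟩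
  x zero                                       ∎
  where open ≡-Reasoning
unit-· {suc m} (suc e) x =
  trans (cong₂ _+_ (ℚP.*-zeroˡ (x zero)) (unit-· e (tail x))) (ℚP.+-identityˡ (x (suc e)))

·-neg : ∀ {d} (a x : Vector ℚ d) → (λ i → - a i) · x ≡ - (a · x)
·-neg {d} a x = trans (Σℚ-cong d (λ i → sym (ℚP.neg-distribˡ-* (a i) (x i)))) (sym (neg-distrib-Σℚ d _))

·-++ : ∀ {m n} (a : Vector ℚ m) (b : Vector ℚ n) (x : Vector ℚ (m ℕ.+ n)) →
  (a Vector.++ b) · x ≡ a · (x ∘ (_↑ˡ n)) + b · (x ∘ (m ↑ʳ_))
·-++ {m} {n} a b x = trans (Σℚ-++ m _)
  (cong₂ _+_ (·-cong (VectorP.lookup-++ˡ a b) (λ _ → refl)) (·-cong (VectorP.lookup-++ʳ a b) (λ _ → refl)))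

-- Fourier–Motzkin elimination

infix 4 _·x≥_
record LinIneq (d : ℕ) : Set where
  constructor _·x≥_
  field
    coeff : Vector ℚ d
    bound : ℚ
open LinIneq

infix 4 _⊨_ _⊨*_
_⊨_ : ∀ {d} → Vector ℚ d → LinIneq d → Set
x ⊨ c = bound c ≤ coeff c · x

_⊨*_ : ∀ {d} → Vector ℚ d → List (LinIneq d) → Set
x ⊨* cs = All (x ⊨_) cs

⊨*-cong : ∀ {d} {x y : Vector ℚ d} {cs} → (∀ i → x i ≡ y i) → x ⊨* cs → y ⊨* cs
⊨*-cong x≗y = All.map (λ {c} → subst (bound c ≤_) (·-cong {a = coeff c} (λ _ → refl) x≗y))

combine : ∀ {d} → ℚ → LinIneq d → ℚ → LinIneq d → LinIneq d
combine u p w n = (λ i → u * coeff p i + w * coeff n i) ·x≥ (u * bound p + w * bound n)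

⊨-combine : ∀ {d} {u w} {x : Vector ℚ d} {p n} → 0ℚ ≤ u → 0ℚ ≤ w → x ⊨ p → x ⊨ n → x ⊨ combine u p w n
⊨-combine {u = u} {w} {x} {p} {n} 0≤u 0≤w x⊨p x⊨n =
  subst (_ ≤_) (sym (·-linearˡ u w (coeff p) (coeff n) x))
    (ℚP.+-mono-≤ (ℚP.*-monoˡ-≤-nonNeg u {{nonNegative 0≤u}} x⊨p)
                 (ℚP.*-monoˡ-≤-nonNeg w {{nonNegative 0≤w}} x⊨n))

⊨-combine-tight : ∀ {d} {u w} {x : Vector ℚ d} {p n} → 0ℚ < w → coeff p · x ≡ bound p →
  x ⊨ combine u p w n → x ⊨ n
⊨-combine-tight {u = u} {w} {x} {p} {n} 0<w p-tight x⊨pn =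
  ℚP.*-cancelˡ-≤-pos w {{positive 0<w}} (+-cancelˡ-≤ (u * bound p)
    (subst (_ ≤_) (trans (·-linearˡ u w (coeff p) (coeff n) x) (cong (λ z → u * z + _) p-tight)) x⊨pn))

module _ {d : ℕ} where

  lead : LinIneq (suc d) → ℚ
  lead c = head (coeff c)

  dropLead : LinIneq (suc d) → LinIneq d
  dropLead c = tail (coeff c) ·x≥ bound c

  threshold : (c : LinIneq (suc d)) → Vector ℚ d → .{{NonZero (lead c)}} → ℚ
  threshold c y = (bound c - tail (coeff c) · y) ÷ lead c

  threshold-tight : ∀ c y .{{_ : NonZero (lead c)}} → coeff c · (threshold c y ∷ y) ≡ bound c
  threshold-tight c y = trans (cong (_+ s) (*-÷-inverse (lead c) (bound c - s))) (p-q+q≡p (bound c) s)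
    where s = tail (coeff c) · y

  ⊨-∷-zero : ∀ c y t → lead c ≡ 0ℚ → (t ∷ y) ⊨ c ⇔ y ⊨ dropLead c
  ⊨-∷-zero c y t a≡0 = mk⇔ (subst (bound c ≤_) vanish) (subst (bound c ≤_) (sym vanish))
    where
    s = tail (coeff c) · y
    vanish : lead c * t + s ≡ s
    vanish = trans (cong (λ a → a * t + s) a≡0) (trans (cong (_+ s) (ℚP.*-zeroˡ t)) (ℚP.+-identityˡ s))

  ⊨-∷-pos : ∀ c y t (0<a : 0ℚ < lead c) → (t ∷ y) ⊨ c ⇔ threshold c y {{>-nonZero 0<a}} ≤ t
  ⊨-∷-pos c y t 0<a = mk⇔
    (ℚP.*-cancelˡ-≤-pos (lead c) {{positive 0<a}} ∘ Equivalence.to affine)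
    (Equivalence.from affine ∘ ℚP.*-monoˡ-≤-nonNeg (lead c) {{nonNegative (ℚP.<⇒≤ 0<a)}})
    where
    affine = ≤-affine⇔ (lead c) (bound c) (tail (coeff c) · y) t {{>-nonZero 0<a}}

  ⊨-∷-neg : ∀ c y t (a<0 : lead c < 0ℚ) → (t ∷ y) ⊨ c ⇔ t ≤ threshold c y {{<-nonZero a<0}}
  ⊨-∷-neg c y t a<0 = mk⇔
    (ℚP.*-cancelˡ-≤-neg (lead c) {{negative a<0}} ∘ Equivalence.to affine)
    (Equivalence.from affine ∘ ℚP.*-monoˡ-≤-nonPos (lead c) {{nonPositive (ℚP.<⇒≤ a<0)}})
    where
    affine = ≤-affine⇔ (lead c) (bound c) (tail (coeff c) · y) t {{<-nonZero a<0}}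

  private
    lead≟0 : ∀ c → Dec (lead c ≡ 0ℚ)
    lead≟0 c = lead c ≟ 0ℚ

  -- Clamping the weights at 0 makes every combination a consequence of cs; when
  -- lead p > 0 > lead n they are − lead n and lead p, which cancel the leading variable.
  cancelLead : LinIneq (suc d) → LinIneq (suc d) → LinIneq (suc d)
  cancelLead p n = combine (0ℚ ⊔ - lead n) p (0ℚ ⊔ lead p) n

  consequences : List (LinIneq (suc d)) → List (LinIneq (suc d))
  consequences cs = cs ++ cartesianProductWith cancelLead cs cs

  eliminate : List (LinIneq (suc d)) → List (LinIneq d)
  eliminate cs = map dropLead (filter lead≟0 (consequences cs))

  ⊨-consequences : ∀ {cs} {x : Vector ℚ (suc d)} → x ⊨* cs → x ⊨* consequences cs
  ⊨-consequences {cs} {x} x⊨cs = AllP.++⁺ x⊨cs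
    (AllP.cartesianProductWith⁺ (setoid _) (setoid _) cancelLead cs cs λ {p} {n} p∈ n∈ →
      ⊨-combine {x = x} {p} {n} (ℚP.p≤p⊔q 0ℚ (- lead n)) (ℚP.p≤p⊔q 0ℚ (lead p))
                (All.lookup x⊨cs p∈) (All.lookup x⊨cs n∈))

  eliminate-sound : ∀ {cs} (x : Vector ℚ (suc d)) → x ⊨* cs → tail x ⊨* eliminate cs
  eliminate-sound {cs} x x⊨cs = AllP.map⁺ (All.zipWith
    (λ {c} (a≡0 , x⊨c) → Equivalence.to (⊨-∷-zero c (tail x) (head x) a≡0) x⊨c)
    (AllP.all-filter lead≟0 (consequences cs) , AllP.filter⁺ lead≟0 (⊨-consequences {cs} {x} x⊨cs)))

  lead-cancelLead : ∀ {p n} → 0ℚ < lead p → lead n < 0ℚ → lead (cancelLead p n) ≡ 0ℚ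
  lead-cancelLead {p} {n} 0<a a′<0 = begin
    (0ℚ ⊔ - lead n) * lead p + (0ℚ ⊔ lead p) * lead n
      ≡⟨ cong₂ (λ u w → u * lead p + w * lead n)
           (ℚP.p≤q⇒p⊔q≡q (ℚP.<⇒≤ (ℚP.neg-antimono-< a′<0))) (ℚP.p≤q⇒p⊔q≡q (ℚP.<⇒≤ 0<a)) ⟩
    (- lead n) * lead p + lead p * lead n
      ≡⟨ cancel (lead p) (lead n) ⟩
    0ℚ ∎
    where
    open ≡-Reasoning
    cancel : ∀ a a′ → (- a′) * a + a * a′ ≡ 0ℚ
    cancel = solve 2 (λ a a′ → (:- a′) :* a :+ a :* a′ := con 0ℚ) refl

  threshold-≤ : ∀ {p n} y (0<a : 0ℚ < lead p) (a′<0 : lead n < 0ℚ) → y ⊨ dropLead (cancelLead p n) →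
    threshold p y {{>-nonZero 0<a}} ≤ threshold n y {{<-nonZero a′<0}}
  threshold-≤ {p} {n} y 0<a a′<0 y⊨ = Equivalence.to (⊨-∷-neg n y θ a′<0)
    (⊨-combine-tight {u = 0ℚ ⊔ - lead n} {x = θ ∷ y} {p} {n} 0<0⊔a (threshold-tight p y {{>-nonZero 0<a}})
      (Equivalence.from (⊨-∷-zero (cancelLead p n) y θ (lead-cancelLead {p} {n} 0<a a′<0)) y⊨))
    where
    θ = threshold p y {{>-nonZero 0<a}}
    0<0⊔a : 0ℚ < 0ℚ ⊔ lead p
    0<0⊔a = subst (0ℚ <_) (sym (ℚP.p≤q⇒p⊔q≡q (ℚP.<⇒≤ 0<a))) 0<a

  lowerThreshold : ℚ → Vector ℚ d → LinIneq (suc d) → ℚ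
  lowerThreshold B y c with ℚP.<-cmp 0ℚ (lead c)
  ... | tri< 0<a _ _ = threshold c y {{>-nonZero 0<a}}
  ... | tri≈ _ _ _   = B
  ... | tri> _ _ _   = B

  lowerThreshold-pos : ∀ B y c (0<a : 0ℚ < lead c) → lowerThreshold B y c ≡ threshold c y {{>-nonZero 0<a}}
  lowerThreshold-pos B y c 0<a with ℚP.<-cmp 0ℚ (lead c)
  ... | tri< _ _ _    = refl
  ... | tri≈ ¬0<a _ _ = ⊥-elim (¬0<a 0<a)
  ... | tri> ¬0<a _ _ = ⊥-elim (¬0<a 0<a)

  lowerThreshold-≤ : ∀ B y c {t} → B ≤ t → ((0<a : 0ℚ < lead c) → threshold c y {{>-nonZero 0<a}} ≤ t) →
    lowerThreshold B y c ≤ t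
  lowerThreshold-≤ B y c B≤t θ≤t with ℚP.<-cmp 0ℚ (lead c)
  ... | tri< 0<a _ _ = θ≤t 0<a
  ... | tri≈ _ _ _   = B≤t
  ... | tri> _ _ _   = B≤t

  upperThreshold : Vector ℚ d → LinIneq (suc d) → ℚ
  upperThreshold y c with ℚP.<-cmp 0ℚ (lead c)
  ... | tri> _ _ a<0 = threshold c y {{<-nonZero a<0}}
  ... | tri< _ _ _   = 0ℚ
  ... | tri≈ _ _ _   = 0ℚ

  upperThreshold-neg : ∀ y c (a<0 : lead c < 0ℚ) → upperThreshold y c ≡ threshold c y {{<-nonZero a<0}}
  upperThreshold-neg y c a<0 with ℚP.<-cmp 0ℚ (lead c)
  ... | tri> _ _ _    = refl
  ... | tri< _ _ ¬a<0 = ⊥-elim (¬a<0 a<0)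
  ... | tri≈ _ _ ¬a<0 = ⊥-elim (¬a<0 a<0)

  leastLift : ℚ → Vector ℚ d → List (LinIneq (suc d)) → ℚ
  leastLift B y cs = ℚExtrema.max B (map (lowerThreshold B y) cs)

  leastLift-≤ : ∀ {B y cs t} → B ≤ t → (∀ {c} → c ∈ₗ cs → 0ℚ < lead c → (t ∷ y) ⊨ c) → leastLift B y cs ≤ t
  leastLift-≤ {B} {y} {cs} {t} B≤t pos⊨ = ℚExtrema.max≤v⁺ B≤t (AllP.map⁺ (All.tabulate λ {c} c∈ →
    lowerThreshold-≤ B y c B≤t (λ 0<a → Equivalence.to (⊨-∷-pos c y t 0<a) (pos⊨ c∈ 0<a))))

  leastLift-⊨* : ∀ {B y cs} → (∀ {c} → c ∈ₗ cs → lead c ≡ 0ℚ → y ⊨ dropLead c) →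
    (∀ {c} → c ∈ₗ cs → (a<0 : lead c < 0ℚ) → leastLift B y cs ≤ threshold c y {{<-nonZero a<0}}) →
    (leastLift B y cs ∷ y) ⊨* cs
  leastLift-⊨* {B} {y} {cs} zero⊨ neg≤ = All.tabulate lift⊨
    where
    t* = leastLift B y cs
    lift⊨ : ∀ {c} → c ∈ₗ cs → (t* ∷ y) ⊨ c
    lift⊨ {c} c∈ with ℚP.<-cmp 0ℚ (lead c)
    ... | tri< 0<a _ _ = Equivalence.from (⊨-∷-pos c y t* 0<a)
      (subst (_≤ t*) (lowerThreshold-pos B y c 0<a) (All.lookup (AllP.map⁻ (ℚExtrema.xs≤max B _)) c∈))
    ... | tri≈ _ 0≡a _ = Equivalence.from (⊨-∷-zero c y t* (sym 0≡a)) (zero⊨ c∈ (sym 0≡a))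
    ... | tri> _ _ a<0 = Equivalence.from (⊨-∷-neg c y t* a<0) (neg≤ c∈ a<0)

  eliminate-complete : ∀ cs y → y ⊨* eliminate cs → ∃[ t ] (t ∷ y) ⊨* cs
  eliminate-complete cs y y⊨ = leastLift B y cs , leastLift-⊨* (kept ∘ ∈-++⁺ˡ) neg≤
    where
    B = ℚExtrema.min 0ℚ (map (upperThreshold y) cs)
    kept : ∀ {c} → c ∈ₗ consequences cs → lead c ≡ 0ℚ → y ⊨ dropLead c
    kept c∈ a≡0 = All.lookup (AllP.map⁻ y⊨) (∈-filter⁺ lead≟0 c∈ a≡0)
    neg≤ : ∀ {c} → c ∈ₗ cs → (a<0 : lead c < 0ℚ) → leastLift B y cs ≤ threshold c y {{<-nonZero a<0}}
    neg≤ {c} c∈ a<0 = leastLift-≤ {B} {y} {cs}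
      (subst (B ≤_) (upperThreshold-neg y c a<0) (All.lookup (AllP.map⁻ (ℚExtrema.min≤xs 0ℚ _)) c∈))
      (λ {p} p∈ 0<a → Equivalence.from (⊨-∷-pos p y _ 0<a)
        (threshold-≤ {p} {c} y 0<a a<0 (kept (∈-++⁺ʳ cs (∈-cartesianProductWith⁺ cancelLead p∈ c∈))
                                     (lead-cancelLead {p} {c} 0<a a<0))))

  minimal-lift : ∀ {cs y t₀ L} → (t₀ ∷ y) ⊨* cs → (∀ t → (t ∷ y) ⊨* cs → L ≤ t) →
    ∃[ t* ] ((t* ∷ y) ⊨* cs × (∀ t → (t ∷ y) ⊨* cs → t* ≤ t))
  minimal-lift {cs} {y} {t₀} {L} t₀⊨ L≤ = leastLift L y cs , leastLift-⊨* zero⊨ neg≤ , least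
    where
    least : ∀ t → (t ∷ y) ⊨* cs → leastLift L y cs ≤ t
    least t t⊨ = leastLift-≤ {L} {y} {cs} (L≤ t t⊨) (λ c∈ _ → All.lookup t⊨ c∈)
    zero⊨ : ∀ {c} → c ∈ₗ cs → lead c ≡ 0ℚ → y ⊨ dropLead c
    zero⊨ {c} c∈ a≡0 = Equivalence.to (⊨-∷-zero c y t₀ a≡0) (All.lookup t₀⊨ c∈)
    neg≤ : ∀ {c} → c ∈ₗ cs → (a<0 : lead c < 0ℚ) → leastLift L y cs ≤ threshold c y {{<-nonZero a<0}}
    neg≤ {c} c∈ a<0 = ℚP.≤-trans (least t₀ t₀⊨) (Equivalence.to (⊨-∷-neg c y t₀ a<0) (All.lookup t₀⊨ c∈))

eliminateAll : ∀ m {j} → List (LinIneq (m ℕ.+ j)) → List (LinIneq j)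
eliminateAll zero    cs = cs
eliminateAll (suc m) cs = eliminateAll m (eliminate cs)

eliminateAll-sound : ∀ m {j} {cs : List (LinIneq (m ℕ.+ j))} x →
  x ⊨* cs → (x ∘ (m ↑ʳ_)) ⊨* eliminateAll m cs
eliminateAll-sound zero    x x⊨ = x⊨
eliminateAll-sound (suc m) x x⊨ = eliminateAll-sound m (tail x) (eliminate-sound x x⊨)

eliminateAll-complete : ∀ m {j} (cs : List (LinIneq (m ℕ.+ j))) y → y ⊨* eliminateAll m cs →
  ∃[ x ] (x ⊨* cs × x ∘ (m ↑ʳ_) ≡ y)
eliminateAll-complete zero    cs y y⊨ = y , y⊨ , refl
eliminateAll-complete (suc m) cs y y⊨ =
  let (x , x⊨ , x≡y) = eliminateAll-complete m (eliminate cs) y y⊨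
      (t , t⊨)       = eliminate-complete cs x x⊨
  in t ∷ x , t⊨ , x≡y

-- Linear programs attain their minimum

module _ {d : ℕ} (cs : List (LinIneq d)) (obj : Vector ℚ d) where
  private
    front : Vector ℚ (d ℕ.+ 1) → Vector ℚ d
    front z = z ∘ (_↑ˡ 1)

    back : Vector ℚ (d ℕ.+ 1) → ℚ
    back z = z (d ↑ʳ zero)

    widen : LinIneq d → LinIneq (d ℕ.+ 1)
    widen c = (coeff c Vector.++ (λ _ → 0ℚ)) ·x≥ bound c

    objectiveRow : LinIneq (d ℕ.+ 1)
    objectiveRow = (Vector.map -_ obj Vector.++ (λ _ → 1ℚ)) ·x≥ 0ℚ

    widen-· : ∀ c z → coeff (widen c) · z ≡ coeff c · front z
    widen-· c z = begin
      coeff (widen c) · z                           ≡⟨ ·-++ (coeff c) (λ _ → 0ℚ) z ⟩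
      coeff c · front z + (0ℚ * back z + 0ℚ)
        ≡⟨ cong (λ u → coeff c · front z + (u + 0ℚ)) (ℚP.*-zeroˡ (back z)) ⟩
      coeff c · front z + 0ℚ                        ≡⟨ ℚP.+-identityʳ _ ⟩
      coeff c · front z                             ∎
      where open ≡-Reasoning

    objectiveRow-· : ∀ z → coeff objectiveRow · z ≡ back z - obj · front z
    objectiveRow-· z = begin
      coeff objectiveRow · z                        ≡⟨ ·-++ (Vector.map -_ obj) (λ _ → 1ℚ) z ⟩
      (λ i → - obj i) · front z + (1ℚ * back z + 0ℚ)
        ≡⟨ cong₂ _+_ (·-neg obj (front z)) (trans (ℚP.+-identityʳ _) (ℚP.*-identityˡ (back z))) ⟩
      - (obj · front z) + back z                    ≡⟨ ℚP.+-comm _ (back z) ⟩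
      back z - obj · front z                        ∎
      where open ≡-Reasoning

  epigraph : List (LinIneq (d ℕ.+ 1))
  epigraph = map widen cs ∷ʳ objectiveRow

  ⊨-epigraph⇔ : ∀ z → z ⊨* epigraph ⇔ (front z ⊨* cs × obj · front z ≤ back z)
  ⊨-epigraph⇔ z = mk⇔
    (λ z⊨ → let (z⊨cs , z⊨row) = AllP.∷ʳ⁻ z⊨ in
      All.map (λ {c} → subst (bound c ≤_) (widen-· c z)) (AllP.map⁻ z⊨cs) ,
      Equivalence.from (p≤q⇔0≤q-p _ _) (subst (0ℚ ≤_) (objectiveRow-· z) z⊨row))
    (λ (x⊨cs , obj≤t) → AllP.∷ʳ⁺
      (AllP.map⁺ (All.map (λ {c} → subst (bound c ≤_) (sym (widen-· c z))) x⊨cs))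
      (subst (0ℚ ≤_) (sym (objectiveRow-· z)) (Equivalence.to (p≤q⇔0≤q-p _ _) obj≤t)))

  shadow : List (LinIneq 1)
  shadow = eliminateAll d epigraph

  ⊨-shadow : ∀ {x t} → x ⊨* cs → obj · x ≤ t → (t ∷ []) ⊨* shadow
  ⊨-shadow {x} {t} x⊨cs obj≤t = ⊨*-cong back≡t (eliminateAll-sound d z
    (Equivalence.from (⊨-epigraph⇔ z)
      (⊨*-cong x≗front x⊨cs , subst₂ _≤_ (·-cong {a = obj} (λ _ → refl) x≗front) t≡back obj≤t)))
    where
    z = x Vector.++ (λ _ → t)
    x≗front : ∀ i → x i ≡ front z i
    x≗front i = sym (VectorP.lookup-++ˡ x (λ _ → t) i)
    t≡back : t ≡ back z
    t≡back = sym (VectorP.lookup-++ʳ x (λ _ → t) zero)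
    back≡t : ∀ i → z (d ↑ʳ i) ≡ (t ∷ []) i
    back≡t zero = sym t≡back

  ⊨-shadow⁻ : ∀ {t} → (t ∷ []) ⊨* shadow → ∃[ x ] (x ⊨* cs × obj · x ≤ t)
  ⊨-shadow⁻ {t} t⊨ =
    let (z , z⊨ , back≡t)    = eliminateAll-complete d epigraph (t ∷ []) t⊨
        (x⊨cs , obj≤back) = Equivalence.to (⊨-epigraph⇔ z) z⊨
    in front z , x⊨cs , subst (obj · front z ≤_) (cong-app back≡t zero) obj≤back

lp-minimum-attained : ∀ {d} (cs : List (LinIneq d)) (obj : Vector ℚ d) {x₀ L} →
  x₀ ⊨* cs → (∀ x → x ⊨* cs → L ≤ obj · x) →
  ∃[ x* ] (x* ⊨* cs × (∀ x → x ⊨* cs → obj · x* ≤ obj · x))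
lp-minimum-attained cs obj {x₀} {L} x₀⊨ L≤obj =
  let (t* , t*⊨ , t*-least) = minimal-lift {cs = shadow cs obj} {y = []} (⊨-shadow cs obj x₀⊨ ℚP.≤-refl) L≤t
      (x* , x*⊨ , obj≤t*)  = ⊨-shadow⁻ cs obj t*⊨
  in x* , x*⊨ , λ x x⊨ → ℚP.≤-trans obj≤t* (t*-least (obj · x) (⊨-shadow cs obj x⊨ ℚP.≤-refl))
  where
  L≤t : ∀ t → (t ∷ []) ⊨* shadow cs obj → L ≤ t
  L≤t t t⊨ = let (x , x⊨ , obj≤t) = ⊨-shadow⁻ cs obj t⊨ in ℚP.≤-trans (L≤obj x x⊨) obj≤t

-- Fractional edge covers and independent sets

indicator : Bool → ℚ
indicator b = if b then 1ℚ else 0ℚ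

indicator-* : ∀ b q → indicator b * q ≡ (if b then q else 0ℚ)
indicator-* true  q = ℚP.*-identityˡ q
indicator-* false q = ℚP.*-zeroˡ q

indicator-≤ : ∀ b {q} → (b ≡ true → 1ℚ ≤ q) → 0ℚ ≤ q → indicator b ≤ q
indicator-≤ true  1≤q _   = 1≤q refl
indicator-≤ false _   0≤q = 0≤q

if-mono : ∀ b {p q} → p ≤ q → (if b then p else 0ℚ) ≤ (if b then q else 0ℚ)
if-mono true  p≤q = p≤q
if-mono false _   = ℚP.≤-refl

if-nonNeg : ∀ b {q} → 0ℚ ≤ q → 0ℚ ≤ (if b then q else 0ℚ)
if-nonNeg true  0≤q = 0≤q
if-nonNeg false _   = ℚP.≤-refl

module _ (H : Hypergraph) where
  open Hypergraph H

  coverage : Vector ℚ m → Fin n → ℚ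
  coverage γ v = Σℚ m (λ e → if lookup (E e) v then γ e else 0ℚ)

  incidence : Fin n → Vector ℚ m
  incidence v e = indicator (lookup (E e) v)

  incidence-· : ∀ v γ → incidence v · γ ≡ coverage γ v
  incidence-· v γ = Σℚ-cong m (λ e → indicator-* (lookup (E e) v) (γ e))

  -- A vertex outside X gets the vacuous bound coverage ≥ 0, so all vertices can be tabulated.
  coverSystem : Subset n → List (LinIneq m)
  coverSystem X = tabulate (λ e → unit e ·x≥ 0ℚ)
               ++ tabulate (λ e → (λ i → - unit e i) ·x≥ - 1ℚ)
               ++ tabulate (λ v → incidence v ·x≥ indicator (lookup X v))

  ⊨-coverSystem⇔ : ∀ X γ → γ ⊨* coverSystem X ⇔ IsFracCover H X γ
  ⊨-coverSystem⇔ X γ = mk⇔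
    (λ γ⊨ → let (⊨lower , ⊨rest) = AllP.++⁻ _ γ⊨ ; (⊨upper , ⊨cover) = AllP.++⁻ _ ⊨rest in
      (λ e → subst (0ℚ ≤_) (unit-· e γ) (AllP.tabulate⁻ ⊨lower e) ,
             subst (_≤ 1ℚ) (neg-involutive (γ e))
               (ℚP.neg-antimono-≤ (subst (- 1ℚ ≤_) (neg-unit-· e) (AllP.tabulate⁻ ⊨upper e)))) ,
      (λ v v∈X → subst₂ _≤_ (cong indicator (VecP.[]=⇒lookup v∈X)) (incidence-· v γ)
                   (AllP.tabulate⁻ ⊨cover v)))
    (λ (bounds , covers) → AllP.++⁺
      (AllP.tabulate⁺ λ e → subst (0ℚ ≤_) (sym (unit-· e γ)) (proj₁ (bounds e)))
      (AllP.++⁺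
      (AllP.tabulate⁺ λ e → subst (- 1ℚ ≤_) (sym (neg-unit-· e)) (ℚP.neg-antimono-≤ (proj₂ (bounds e))))
      (AllP.tabulate⁺ λ v → subst (indicator (lookup X v) ≤_) (sym (incidence-· v γ))
        (indicator-≤ (lookup X v) (λ v∈X → covers v (VecP.lookup⇒[]= v X v∈X))
          (Σℚ-nonNeg m (λ e → if-nonNeg (lookup (E e) v) (proj₁ (bounds e))))))))
    where
    neg-unit-· : ∀ e → (λ i → - unit e i) · γ ≡ - γ e
    neg-unit-· e = trans (·-neg (unit e) γ) (cong -_ (unit-· e γ))

  weight-nonNeg : ∀ {X γ} → IsFracCover H X γ → 0ℚ ≤ weight H γ
  weight-nonNeg (bounds , _) = Σℚ-nonNeg m (proj₁ ∘ bounds)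

  weight-· : ∀ γ → weight H γ ≡ (λ _ → 1ℚ) · γ
  weight-· γ = Σℚ-cong m (λ e → sym (ℚP.*-identityˡ (γ e)))

  allOnes-cover : ∀ X → IsFracCover H X (λ _ → 1ℚ)
  allOnes-cover X = (λ _ → 0≤1 , ℚP.≤-refl) , λ v _ →
    let (e , v∈e) = covered v in
    subst (_≤ coverage (λ _ → 1ℚ) v) (cong indicator (VecP.[]=⇒lookup v∈e))
      (Σℚ-≥-term m (λ e′ → if-nonNeg (lookup (E e′) v) (0≤1)) e)

  rhoStar-exists : ∀ X → ∃[ r ] IsRhoStar H X r
  rhoStar-exists X =
    let (γ , γ⊨ , minimal) = lp-minimum-attained (coverSystem X) (λ _ → 1ℚ) {x₀ = λ _ → 1ℚ} {L = 0ℚ}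
          (Equivalence.from (⊨-coverSystem⇔ X _) (allOnes-cover X))
          (λ γ γ⊨ → subst (0ℚ ≤_) (weight-· γ) (weight-nonNeg (Equivalence.to (⊨-coverSystem⇔ X γ) γ⊨)))
    in weight H γ , (γ , Equivalence.to (⊨-coverSystem⇔ X γ) γ⊨ , refl) , λ γ′ γ′-cover →
       subst₂ _≤_ (sym (weight-· γ)) (sym (weight-· γ′))
         (minimal γ′ (Equivalence.from (⊨-coverSystem⇔ X γ′) γ′-cover))

  MisAtMost : ℕ → Subset n → Set
  MisAtMost k S = ∀ I → I ⊆ S → Independent H I → ∣ I ∣ ℕ.≤ k

  MisAtMost-zero : ∀ {S} → MisAtMost 0 S → Empty S
  MisAtMost-zero {S} mis (v , v∈S) = ℕP.<⇒≱ (ℕ.s≤s ℕ.z≤n) (subst (ℕ._≤ 0) (SubsetP.∣⁅x⁆∣≡1 v)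
    (mis ⁅ v ⁆ (λ x∈⁅v⁆ → subst (_∈ S) (sym (SubsetP.x∈⁅y⁆⇒x≡y v x∈⁅v⁆)) v∈S)
      (λ _ a b a∈ b∈ _ _ → trans (SubsetP.x∈⁅y⁆⇒x≡y v a∈) (sym (SubsetP.x∈⁅y⁆⇒x≡y v b∈)))))

  Independent-⁅⁆∪ : ∀ {v I} → Independent H I → (∀ {w} e → w ∈ I → v ∈ E e → w ∈ E e → ⊥) →
    Independent H (⁅ v ⁆ ∪ I)
  Independent-⁅⁆∪ {v} {I} indep apart e a b a∈ b∈ a∈e b∈e =
    same (SubsetP.x∈p∪q⁻ ⁅ v ⁆ I a∈) (SubsetP.x∈p∪q⁻ ⁅ v ⁆ I b∈)
    where
    same : a ∈ ⁅ v ⁆ ⊎ a ∈ I → b ∈ ⁅ v ⁆ ⊎ b ∈ I → a ≡ b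
    same (inj₁ a∈v) (inj₁ b∈v) = trans (SubsetP.x∈⁅y⁆⇒x≡y v a∈v) (sym (SubsetP.x∈⁅y⁆⇒x≡y v b∈v))
    same (inj₂ a∈I) (inj₂ b∈I) = indep e a b a∈I b∈I a∈e b∈e
    same (inj₁ a∈v) (inj₂ b∈I) = ⊥-elim (apart e b∈I (subst (_∈ E e) (SubsetP.x∈⁅y⁆⇒x≡y v a∈v) a∈e) b∈e)
    same (inj₂ a∈I) (inj₁ b∈v) = ⊥-elim (apart e a∈I (subst (_∈ E e) (SubsetP.x∈⁅y⁆⇒x≡y v b∈v) b∈e) a∈e)

  MisAtMost-∖ : ∀ {k S B v} → v ∈ S → v ∈ B → (∀ {w} e → w ∈ S → v ∈ E e → w ∈ E e → w ∈ B) →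
    MisAtMost (suc k) S → MisAtMost k (S ∩ ∁ B)
  MisAtMost-∖ {k} {S} {B} {v} v∈S v∈B nbrs∈B mis I I⊆S∖B indep = ℕP.≤-pred (ℕP.≤-trans
    (SubsetP.p⊂q⇒∣p∣<∣q∣ (SubsetP.q⊆p∪q ⁅ v ⁆ I , v , SubsetP.x∈p∪q⁺ (inj₁ (SubsetP.x∈⁅x⁆ v)) , ∉B v∈B))
    (mis (⁅ v ⁆ ∪ I) ⊆S (Independent-⁅⁆∪ indep (λ e w∈I v∈e w∈e → ∉B (nbrs∈B e (∈S w∈I) v∈e w∈e) w∈I))))
    where
    ∈S : ∀ {w} → w ∈ I → w ∈ S
    ∈S w∈I = proj₁ (SubsetP.x∈p∩q⁻ S (∁ B) (I⊆S∖B w∈I))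
    ∉B : ∀ {w} → w ∈ B → w ∉ I
    ∉B w∈B w∈I = SubsetP.x∈∁p⇒x∉p (proj₂ (SubsetP.x∈p∩q⁻ S (∁ B) (I⊆S∖B w∈I))) w∈B
    ⊆S : ⁅ v ⁆ ∪ I ⊆ S
    ⊆S w∈ with SubsetP.x∈p∪q⁻ ⁅ v ⁆ I w∈
    ... | inj₁ w∈v = subst (_∈ S) (sym (SubsetP.x∈⁅y⁆⇒x≡y v w∈v)) v∈S
    ... | inj₂ w∈I = ∈S w∈I

  empty-cover : ∀ {S} → Empty S → IsFracCover H S (λ _ → 0ℚ)
  empty-cover S-empty = (λ _ → ℚP.≤-refl , 0≤1) , λ v v∈S → ⊥-elim (S-empty (v , v∈S))

  cover-⊔ : ∀ {S X Y γ δ} → IsFracCover H X γ → IsFracCover H Y δ → (∀ {v} → v ∈ S → v ∈ X ⊎ v ∈ Y) →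
    IsFracCover H S (λ e → γ e ⊔ δ e)
  cover-⊔ {X = X} {Y} {γ} {δ} (γ-bounds , γ-covers) (δ-bounds , δ-covers) S⊆X∪Y =
    (λ e → ℚP.≤-trans (proj₁ (γ-bounds e)) (ℚP.p≤p⊔q (γ e) (δ e)) ,
           ℚP.⊔-lub (proj₂ (γ-bounds e)) (proj₂ (δ-bounds e))) ,
    λ v v∈S → covered-by (S⊆X∪Y v∈S)
    where
    covered-by : ∀ {v} → v ∈ X ⊎ v ∈ Y → 1ℚ ≤ coverage (λ e → γ e ⊔ δ e) v
    covered-by {v} (inj₁ v∈X) = ℚP.≤-trans (γ-covers v v∈X)
      (Σℚ-mono-≤ m (λ e → if-mono (lookup (E e) v) (ℚP.p≤p⊔q (γ e) (δ e))))
    covered-by {v} (inj₂ v∈Y) = ℚP.≤-trans (δ-covers v v∈Y)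
      (Σℚ-mono-≤ m (λ e → if-mono (lookup (E e) v) (ℚP.p≤q⊔p (γ e) (δ e))))

  weight-⊔ : ∀ {γ δ} → (∀ e → 0ℚ ≤ γ e) → (∀ e → 0ℚ ≤ δ e) →
    weight H (λ e → γ e ⊔ δ e) ≤ weight H γ + weight H δ
  weight-⊔ {γ} {δ} 0≤γ 0≤δ = subst (weight H (λ e → γ e ⊔ δ e) ≤_) (Σℚ-distrib-+ m γ δ)
    (Σℚ-mono-≤ m (λ e → p⊔q≤p+q (0≤γ e) (0≤δ e)))

-- Tree decompositions

module _ {k} {P : Fin k → Set} (P? : Decidable P) (f : Fin k → ℕ) where
  private
    candidates : List (Fin k)
    candidates = filter P? (allFin k)

    ∈-candidates : ∀ {y} → P y → y ∈ₗ candidates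
    ∈-candidates Py = ∈-filter⁺ P? (∈-allFin _) Py

  ∃-argmin : ∃ P → ∃[ x ] (P x × (∀ {y} → P y → f x ℕ.≤ f y))
  ∃-argmin (x₀ , Px₀) = x , ℕExtrema.argmin-all f Px₀ (AllP.all-filter P? (allFin k)) ,
    λ Py → All.lookup (ℕExtrema.f[argmin]≤f[xs] x₀ candidates) (∈-candidates Py)
    where x = ℕExtrema.argmin f x₀ candidates

  ∃-argmax : ∃ P → ∃[ x ] (P x × (∀ {y} → P y → f y ℕ.≤ f x))
  ∃-argmax (x₀ , Px₀) = x , ℕExtrema.argmax-all f Px₀ (AllP.all-filter P? (allFin k)) ,
    λ Py → All.lookup (ℕExtrema.f[xs]≤f[argmax] x₀ candidates) (∈-candidates Py)
    where x = ℕExtrema.argmax f x₀ candidates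

module _ (T : Tree) where
  open Tree T

  data Descendant (t : Node) : Node → Set where
    self  : Descendant t t
    child : ∀ i → Descendant t (parent i) → Descendant t (suc i)

  descendant⇒toℕ-≤ : ∀ {t a} → Descendant t a → toℕ t ℕ.≤ toℕ a
  descendant⇒toℕ-≤ self        = ℕP.≤-refl
  descendant⇒toℕ-≤ (child i d) = ℕP.≤-trans (descendant⇒toℕ-≤ d) (ℕP.m≤n⇒m≤1+n (parent-earlier i))

  walk-start : ∀ {X a b} → WalkIn X a b → X a
  walk-start (here Xa)     = Xa
  walk-start (step Xa _ _) = Xa

  walk-leaves-subtree-through-root : ∀ {X a b t} → WalkIn X a b → Descendant t a → Descendant t b ⊎ X t
  walk-leaves-subtree-through-root (here _)            d            = inj₁ d
  walk-leaves-subtree-through-root (step Xa (up i) _)  self         = inj₂ Xa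
  walk-leaves-subtree-through-root (step _ (up i) w)   (child .i d) = walk-leaves-subtree-through-root w d
  walk-leaves-subtree-through-root (step _ (down i) w) d            =
    walk-leaves-subtree-through-root w (child i d)

  walk-stays-below-least : ∀ {X a b t} → WalkIn X a b → Descendant t a →
    (∀ c → X c → toℕ t ℕ.≤ toℕ c) → Descendant t b
  walk-stays-below-least (here _)            d            least = d
  walk-stays-below-least (step _ (up i) w)   self         least =
    ⊥-elim (ℕP.<⇒≱ (ℕ.s≤s (parent-earlier i)) (least _ (walk-start w)))
  walk-stays-below-least (step _ (up i) w)   (child .i d) least = walk-stays-below-least w d least
  walk-stays-below-least (step _ (down i) w) d            least = walk-stays-below-least w (child i d) least

module _ {H : Hypergraph} (D : TreeDecomposition H) where
  open Hypergraph H
  open TreeDecomposition D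

  private
    least-bag : ∀ v → ∃[ t ] (v ∈ bag t × (∀ {u} → v ∈ bag u → toℕ t ℕ.≤ toℕ u))
    least-bag v = ∃-argmin (λ u → v SubsetP.∈? bag u) toℕ (vertex-nonempty v)

  top : Fin n → Node
  top v = proj₁ (least-bag v)

  ∈-bag-top : ∀ v → v ∈ bag (top v)
  ∈-bag-top v = proj₁ (proj₂ (least-bag v))

  top-least : ∀ {v u} → v ∈ bag u → toℕ (top v) ℕ.≤ toℕ u
  top-least {v} = proj₂ (proj₂ (least-bag v))

  bag-below-top : ∀ {v u} → v ∈ bag u → Descendant T (top v) u
  bag-below-top {v} {u} v∈u =
    walk-stays-below-least T (vertex-connected v (top v) u (∈-bag-top v) v∈u) self (λ _ → top-least)

  neighbour-∈-bag-top : ∀ {v w} e → v ∈ E e → w ∈ E e → toℕ (top w) ℕ.≤ toℕ (top v) → w ∈ bag (top v)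
  neighbour-∈-bag-top {v} {w} e v∈e w∈e top-w≤top-v = conclude
    (walk-leaves-subtree-through-root T (vertex-connected w u (top w) (E⊆u w∈e) (∈-bag-top w))
      (bag-below-top (E⊆u v∈e)))
    where
    u = proj₁ (edge-covered e)
    E⊆u = proj₂ (edge-covered e)
    conclude : Descendant T (top v) (top w) ⊎ w ∈ bag (top v) → w ∈ bag (top v)
    conclude (inj₁ below)   = subst (λ t → w ∈ bag t)
      (FinP.toℕ-injective (ℕP.≤-antisym top-w≤top-v (descendant⇒toℕ-≤ T below))) (∈-bag-top w)
    conclude (inj₂ w∈top-v) = w∈top-v

  width⇒bag-cover : ∀ {ω} → HasWidth H D ω → ∀ u → ∃[ γ ] (IsFracCover H (bag u) γ × weight H γ ≤ ω)
  width⇒bag-cover {ω} (_ , ρ*≤ω) u =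
    let (r , ρ*) = rhoStar-exists H (bag u)
        ((γ , γ-cover , wγ≡r) , _) = ρ*
    in γ , γ-cover , subst (_≤ ω) (sym wγ≡r) (ρ*≤ω u r ρ*)

  module _ {ω : ℚ} (bag-cover : ∀ u → ∃[ γ ] (IsFracCover H (bag u) γ × weight H γ ≤ ω)) where

    ω-nonNeg : 0ℚ ≤ ω
    ω-nonNeg = let (γ , γ-cover , γ≤ω) = bag-cover zero in ℚP.≤-trans (weight-nonNeg H γ-cover) γ≤ω

    empty-cover-≤ : ∀ k {S} → Empty S → ∃[ γ ] (IsFracCover H S γ × weight H γ ≤ ℕ→ℚ k * ω)
    empty-cover-≤ k S-empty = (λ _ → 0ℚ) , empty-cover H S-empty ,
      subst₂ _≤_ (trans (ℚP.*-zeroˡ ω) (sym (Σℚ-zero m))) refl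
        (ℚP.*-monoʳ-≤-nonNeg ω {{nonNegative ω-nonNeg}} (ℕ→ℚ-nonNeg k))

    cover-by-mis : ∀ k S → MisAtMost H k S → ∃[ γ ] (IsFracCover H S γ × weight H γ ≤ ℕ→ℚ k * ω)
    cover-by-mis zero    S mis = empty-cover-≤ 0 (MisAtMost-zero H mis)
    cover-by-mis (suc k) S mis with SubsetP.nonempty? S
    ... | no  S-empty    = empty-cover-≤ (suc k) S-empty
    ... | yes S-nonempty =
      let (v , v∈S , v-latest) = ∃-argmax (SubsetP._∈? S) (toℕ ∘ top) S-nonempty
          B = bag (top v)
          (γ , γ-cover , γ≤ω)  = bag-cover (top v)
          (δ , δ-cover , δ≤kω) = cover-by-mis k (S ∩ ∁ B) (MisAtMost-∖ H v∈S (∈-bag-top v)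
                                   (λ e w∈S v∈e w∈e → neighbour-∈-bag-top e v∈e w∈e (v-latest w∈S)) mis)
      in (λ e → γ e ⊔ δ e) , cover-⊔ H γ-cover δ-cover (∈-split B) ,
         ℚP.≤-trans (weight-⊔ H (proj₁ ∘ proj₁ γ-cover) (proj₁ ∘ proj₁ δ-cover))
           (subst (weight H γ + weight H δ ≤_) (sym (ℕ→ℚ-suc-* k ω)) (ℚP.+-mono-≤ γ≤ω δ≤kω))
      where
      ∈-split : ∀ B {w} → w ∈ S → w ∈ B ⊎ w ∈ S ∩ ∁ B
      ∈-split B {w} w∈S with w SubsetP.∈? B
      ... | yes w∈B = inj₁ w∈B
      ... | no  w∉B = inj₂ (SubsetP.x∈p∩q⁺ (w∈S , SubsetP.x∉p⇒x∈∁p w∉B))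

lemma3p6 : (H : Hypergraph) (ω : ℚ) (S : Subset (Hypergraph.n H)) (r : ℚ) (k : ℕ) →
    IsFHW H ω → IsRhoStar H S r → IsMis H S k → r ≤ ℕ→ℚ k * ω
lemma3p6 H ω S r k ((D , D-width) , _) (_ , r-least) (_ , mis≤k) =
  let (γ , γ-cover , γ≤kω) = cover-by-mis D (width⇒bag-cover D D-width) k S mis≤k
  in ℚP.≤-trans (r-least γ γ-cover) γ≤kω
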